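{- Let $A$ be a set equipped with a ternary operation $p\colon A^3\to A$ and two constants $0,1\in A$ such that for all $a,b,c,b_1,b_2,b_3\in A$: (C1) $p(0,a,1)=a$; (C2) $p(a,b,a)=a$; (C3) $p(a,p(b_1,b_2,b_3),c)=p(p(a,b_1,c),b_2,p(a,b_3,c))$; (C4) $p(a,0,b)=a=p(b,1,a)$. Define binary operations $a\wedge b=p(0,a,b)$, $a\vee b=p(a,b,1)$ and a unary operation $\bar{a}=p(1,a,0)$. Suppose that $\wedge$ is commutative (or that $\vee$ is commutative). Then the following conditions are equivalent: (i) $(A,\vee,\wedge,\bar{()},0,1)$ is a Boolean algebra (with join $\vee$, meet $\wedge$, complement $\bar{()}$, bottom $0$ and top $1$); (ii) $p(a,b,c)=(\bar{b}\wedge a)\vee(b\wedge c)$ for all $a,b,c\in A$; (iii) $p(a,a,b)=p(0,a,b)$ for all $a,b\in A$. -}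

module Defs where

open import Level using (Level)
open import Relation.Binary.PropositionalEquality using (_≡_)
open import Data.Product using (_×_)

record IsC {a : Level} {A : Set a} (p : A → A → A → A) (z o : A) : Set a where
  field
    C1 : ∀ x → p z x o ≡ x
    C2 : ∀ x y → p x y x ≡ x
    C3 : ∀ x b₁ b₂ b₃ c → p x (p b₁ b₂ b₃) c ≡ p (p x b₁ c) b₂ (p x b₃ c)
    C4 : ∀ x y → (p x z y ≡ x) × (p y o x ≡ x)

module Ops {a : Level} {A : Set a} (p : A → A → A → A) (z o : A) where
  _∧_ : A → A → A
  x ∧ y = p z x y

  _∨_ : A → A → A
  x ∨ y = p x y o

  ¬_ : A → A
  ¬ x = p o x z

{-# OPTIONS --safe #-}
-- Axiom (C3) says that p x b w commutes with (_∧ y) and with (y ∨_) in its outer arguments, and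
-- (C1), (C4) give p x (¬ b) w = p w b x; in particular ¬ b ∧ a = p a b 0 and b ∧ c = p 0 b c.
-- In a Boolean algebra, p a b c = p a b c ∧ (a ∨ c) then splits as (¬ b ∧ a) ∨ (b ∧ c) ∨ (a ∧ c),
-- and the last term is absorbed by the consensus law. Conversely (iii) yields idempotence of ∧,
-- hence absorption, and b ∧ ¬ b = p (¬ b) (¬ b) 0 = p 0 (¬ b) 0 = 0; associativity and
-- distributivity hold in any such algebra, and De Morgan, ¬ (x ∨ y) = ¬ y ∧ ¬ x, transports
-- commutativity between ∧ and ∨.
module Submission where

open import Level using (Level)
open import Data.Product using (_×_; _,_; proj₁; proj₂)
open import Data.Sum using (_⊎_; [_,_]′)
open import Function.Base using (id)
open import Function.Bundles using (_⇔_; mk⇔)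
open import Relation.Binary.PropositionalEquality
  using (_≡_; sym; trans; cong; cong₂; isEquivalence; module ≡-Reasoning)
open import Algebra.Definitions using (Commutative)
open import Algebra.Bundles using (CommutativeSemiring)
open import Algebra.Lattice.Bundles using (BooleanAlgebra)
open import Algebra.Lattice.Structures using (IsBooleanAlgebra; IsDistributiveLattice; IsLattice)
open import Algebra.Lattice.Structures.Biased using (isBooleanAlgebraʳ)
open import Algebra.Consequences.Propositional using (comm∧distrʳ⇒distrˡ; distrib∧absorbs⇒distribˡ; comm∧distrˡ⇒distr)
import Algebra.Lattice.Properties.BooleanAlgebra as BooleanAlgebraProperties
import Algebra.Properties.CommutativeSemigroup as CommutativeSemigroupProperties
import Relation.Binary.Reasoning.Setoid as SetoidReasoning

open import Defs

module _ {c ℓ : Level} (B : BooleanAlgebra c ℓ) where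
  open BooleanAlgebra B
  open BooleanAlgebraProperties B using (∧-identityˡ; ∨-∧-commutativeSemiring)
  open CommutativeSemigroupProperties (CommutativeSemiring.+-commutativeSemigroup ∨-∧-commutativeSemiring)
    using (interchange)
  open SetoidReasoning setoid

  consensus : ∀ x y w → ((¬ x ∧ y) ∨ (x ∧ w)) ∨ (y ∧ w) ≈ (¬ x ∧ y) ∨ (x ∧ w)
  consensus x y w = begin
    (P ∨ Q) ∨ (y ∧ w)              ≈⟨ ∨-congˡ split ⟩
    (P ∨ Q) ∨ ((P ∧ w) ∨ (Q ∧ y))  ≈⟨ interchange P Q (P ∧ w) (Q ∧ y) ⟩
    (P ∨ P ∧ w) ∨ (Q ∨ Q ∧ y)      ≈⟨ ∨-cong (∨-absorbs-∧ P w) (∨-absorbs-∧ Q y) ⟩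
    P ∨ Q                          ∎
    where
    P = ¬ x ∧ y
    Q = x ∧ w
    split : y ∧ w ≈ (P ∧ w) ∨ (Q ∧ y)
    split = begin
      y ∧ w                              ≈⟨ ∧-identityˡ (y ∧ w) ⟨
      ⊤ ∧ (y ∧ w)                        ≈⟨ ∧-congʳ (∨-complementˡ x) ⟨
      (¬ x ∨ x) ∧ (y ∧ w)                ≈⟨ ∧-distribʳ-∨ (y ∧ w) (¬ x) x ⟩
      ¬ x ∧ (y ∧ w) ∨ x ∧ (y ∧ w)        ≈⟨ ∨-cong (∧-assoc (¬ x) y w) (∧-congˡ (∧-comm w y)) ⟨
      (P ∧ w) ∨ x ∧ (w ∧ y)              ≈⟨ ∨-congˡ (∧-assoc x w y) ⟨
      (P ∧ w) ∨ (Q ∧ y)                  ∎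

module _ {a : Level} {A : Set a} {p : A → A → A → A} {z o : A} (C : IsC p z o) where
  open IsC C
  open Ops p z o
  open ≡-Reasoning

  p-zero : ∀ x y → p x z y ≡ x
  p-zero x y = proj₁ (C4 x y)

  p-one : ∀ x y → p x o y ≡ y
  p-one x y = proj₂ (C4 y x)

  p-¬ : ∀ x b y → p x (¬ b) y ≡ p y b x
  p-¬ x b y = trans (C3 x o b z y) (cong₂ (λ u v → p u b v) (p-one x y) (p-zero x y))

  ¬-involutive : ∀ x → ¬ (¬ x) ≡ x
  ¬-involutive x = trans (p-¬ o x z) (C1 x)

  ¬-injective : ∀ {x y} → ¬ x ≡ ¬ y → x ≡ y
  ¬-injective {x} {y} eq = begin
    x          ≡⟨ ¬-involutive x ⟨
    ¬ (¬ x)    ≡⟨ cong ¬_ eq ⟩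
    ¬ (¬ y)    ≡⟨ ¬-involutive y ⟩
    y          ∎

  ¬-distrib-∨ : ∀ x y → ¬ (x ∨ y) ≡ (¬ y) ∧ (¬ x)
  ¬-distrib-∨ x y = begin
    p o (p x y o) z        ≡⟨ C3 o x y o z ⟩
    p (¬ x) y (p o o z)    ≡⟨ cong (p (¬ x) y) (p-one o z) ⟩
    p (¬ x) y z            ≡⟨ p-¬ z y (¬ x) ⟨
    (¬ y) ∧ (¬ x)          ∎

  ∨-comm⇒∧-comm : Commutative _≡_ _∨_ → Commutative _≡_ _∧_
  ∨-comm⇒∧-comm ∨-comm x y = begin
    x ∧ y                      ≡⟨ cong₂ _∧_ (¬-involutive x) (¬-involutive y) ⟨
    (¬ (¬ x)) ∧ (¬ (¬ y))      ≡⟨ ¬-distrib-∨ (¬ y) (¬ x) ⟨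
    ¬ ((¬ y) ∨ (¬ x))          ≡⟨ cong ¬_ (∨-comm (¬ y) (¬ x)) ⟩
    ¬ ((¬ x) ∨ (¬ y))          ≡⟨ ¬-distrib-∨ (¬ x) (¬ y) ⟩
    (¬ (¬ y)) ∧ (¬ (¬ x))      ≡⟨ cong₂ _∧_ (¬-involutive y) (¬-involutive x) ⟩
    y ∧ x                      ∎

  ∧-comm⇒∨-comm : Commutative _≡_ _∧_ → Commutative _≡_ _∨_
  ∧-comm⇒∨-comm ∧-comm x y = ¬-injective (begin
    ¬ (x ∨ y)          ≡⟨ ¬-distrib-∨ x y ⟩
    (¬ y) ∧ (¬ x)      ≡⟨ ∧-comm (¬ y) (¬ x) ⟩
    (¬ x) ∧ (¬ y)      ≡⟨ ¬-distrib-∨ y x ⟨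
    ¬ (y ∨ x)          ∎)

  ∧-assoc : ∀ x y w → (x ∧ y) ∧ w ≡ x ∧ (y ∧ w)
  ∧-assoc x y w = trans (C3 z z x y w) (cong (λ u → p u x (y ∧ w)) (p-zero z w))

  ∨-assoc : ∀ x y w → (x ∨ y) ∨ w ≡ x ∨ (y ∨ w)
  ∨-assoc x y w = sym (trans (C3 x y w o o) (cong (p (x ∨ y) w) (p-one x o)))

  ∧-distribʳ-p : ∀ x b w y → (p x b w) ∧ y ≡ p (x ∧ y) b (w ∧ y)
  ∧-distribʳ-p x b w y = C3 z x b w y

  ∨-distribˡ-p : ∀ y x b w → y ∨ (p x b w) ≡ p (y ∨ x) b (y ∨ w)
  ∨-distribˡ-p y x b w = C3 y x b w o

  IfThenElse : Set a
  IfThenElse = ∀ a b c → p a b c ≡ ((¬ b) ∧ a) ∨ (b ∧ c)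

  DiagonalMeet : Set a
  DiagonalMeet = ∀ a b → p a a b ≡ a ∧ b

  IfThenElse⇒DiagonalMeet : IfThenElse → DiagonalMeet
  IfThenElse⇒DiagonalMeet ite x y = begin
    p x x y                         ≡⟨ ite x x y ⟩
    ((¬ x) ∧ x) ∨ (x ∧ y)           ≡⟨ cong (_∨ (x ∧ y)) ¬x∧x≡0 ⟩
    z ∨ (x ∧ y)                     ≡⟨ C1 (x ∧ y) ⟩
    x ∧ y                           ∎
    where
    ¬x∨x≡1 : (¬ x) ∨ x ≡ o
    ¬x∨x≡1 = begin
      (¬ x) ∨ x                     ≡⟨ cong₂ _∨_ (C1 (¬ x)) (C1 x) ⟨
      ((¬ x) ∧ o) ∨ (x ∧ o)         ≡⟨ ite o x o ⟨
      p o x o                       ≡⟨ C2 o x ⟩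
      o                             ∎
    ¬x∧x≡0 : (¬ x) ∧ x ≡ z
    ¬x∧x≡0 = begin
      (¬ x) ∧ x                     ≡⟨ cong ((¬ x) ∧_) (¬-involutive x) ⟨
      (¬ x) ∧ (¬ (¬ x))             ≡⟨ ¬-distrib-∨ (¬ x) x ⟨
      ¬ ((¬ x) ∨ x)                 ≡⟨ cong ¬_ ¬x∨x≡1 ⟩
      ¬ o                           ≡⟨ p-one o z ⟩
      z                             ∎

  module _ (isBooleanAlgebra : IsBooleanAlgebra _≡_ _∨_ _∧_ ¬_ o z) where
    booleanAlgebra : BooleanAlgebra a a
    booleanAlgebra = record { isBooleanAlgebra = isBooleanAlgebra }

    open IsBooleanAlgebra isBooleanAlgebra using (∧-comm; ∨-comm; ∧-absorbs-∨; ∨-absorbs-∧; ∧-distribˡ-∨)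
    open BooleanAlgebraProperties booleanAlgebra using (∧-idem; ∨-idem; ∨-∧-commutativeSemiring)
    open CommutativeSemigroupProperties (CommutativeSemiring.+-commutativeSemigroup ∨-∧-commutativeSemiring)
      using (interchange)

    IsBooleanAlgebra⇒IfThenElse : IfThenElse
    IsBooleanAlgebra⇒IfThenElse x b y = begin
      T                      ≡⟨ T∧[x∨y]≡T ⟨
      T ∧ (x ∨ y)            ≡⟨ ∧-distribˡ-∨ T x y ⟩
      (T ∧ x) ∨ (T ∧ y)      ≡⟨ cong₂ _∨_ T∧x≡P∨X T∧y≡Q∨X ⟩
      (P ∨ X) ∨ (Q ∨ X)      ≡⟨ interchange P X Q X ⟩
      (P ∨ Q) ∨ (X ∨ X)      ≡⟨ cong ((P ∨ Q) ∨_) (∨-idem X) ⟩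
      (P ∨ Q) ∨ X            ≡⟨ consensus booleanAlgebra b x y ⟩
      P ∨ Q                  ∎
      where
      T = p x b y
      P = (¬ b) ∧ x
      Q = b ∧ y
      X = x ∧ y

      T∧[x∨y]≡T : T ∧ (x ∨ y) ≡ T
      T∧[x∨y]≡T = begin
        T ∧ (x ∨ y)                      ≡⟨ ∧-distribʳ-p x b y (x ∨ y) ⟩
        p (x ∧ (x ∨ y)) b (y ∧ (x ∨ y))  ≡⟨ cong₂ (λ u v → p u b v) (∧-absorbs-∨ x y) y∧[x∨y]≡y ⟩
        T                                ∎
        where
        y∧[x∨y]≡y : y ∧ (x ∨ y) ≡ y
        y∧[x∨y]≡y = trans (cong (y ∧_) (∨-comm x y)) (∧-absorbs-∨ y x)

      T∧x≡P∨X : T ∧ x ≡ P ∨ X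
      T∧x≡P∨X = begin
        T ∧ x                  ≡⟨ ∧-distribʳ-p x b y x ⟩
        p (x ∧ x) b (y ∧ x)    ≡⟨ cong₂ (λ u v → p u b v) (∧-idem x) (∧-comm y x) ⟩
        p x b X                ≡⟨ cong₂ (λ u v → p u b v) X∨x≡x (p-zero X o) ⟨
        p (X ∨ x) b (X ∨ z)    ≡⟨ ∨-distribˡ-p X x b z ⟨
        X ∨ p x b z            ≡⟨ cong (X ∨_) (p-¬ z b x) ⟨
        X ∨ P                  ≡⟨ ∨-comm X P ⟩
        P ∨ X                  ∎
        where
        X∨x≡x : X ∨ x ≡ x
        X∨x≡x = trans (∨-comm X x) (∨-absorbs-∧ x y)

      T∧y≡Q∨X : T ∧ y ≡ Q ∨ X
      T∧y≡Q∨X = begin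
        T ∧ y                  ≡⟨ ∧-distribʳ-p x b y y ⟩
        p X b (y ∧ y)          ≡⟨ cong (p X b) (∧-idem y) ⟩
        p X b y                ≡⟨ cong₂ (λ u v → p u b v) (p-zero X o) X∨y≡y ⟨
        p (X ∨ z) b (X ∨ y)    ≡⟨ ∨-distribˡ-p X z b y ⟨
        X ∨ Q                  ≡⟨ ∨-comm X Q ⟩
        Q ∨ X                  ∎
        where
        X∨y≡y : X ∨ y ≡ y
        X∨y≡y = begin
          X ∨ y                ≡⟨ ∨-comm X y ⟩
          y ∨ (x ∧ y)          ≡⟨ cong (y ∨_) (∧-comm x y) ⟩
          y ∨ (y ∧ x)          ≡⟨ ∨-absorbs-∧ y x ⟩
          y                    ∎

  module _ (diagonal : DiagonalMeet) (∧-comm : Commutative _≡_ _∧_) where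

    ∨-comm : Commutative _≡_ _∨_
    ∨-comm = ∧-comm⇒∨-comm ∧-comm

    ∧-idem : ∀ x → x ∧ x ≡ x
    ∧-idem x = trans (sym (diagonal x x)) (C2 x x)

    ∧-absorbs-∨ : ∀ x y → x ∧ (x ∨ y) ≡ x
    ∧-absorbs-∨ x y = begin
      x ∧ (x ∨ y)            ≡⟨ ∧-comm x (x ∨ y) ⟩
      (x ∨ y) ∧ x            ≡⟨ ∧-distribʳ-p x y o x ⟩
      p (x ∧ x) y (o ∧ x)    ≡⟨ cong₂ (λ u v → p u y v) (∧-idem x) (p-one z x) ⟩
      p x y x                ≡⟨ C2 x y ⟩
      x                      ∎

    ∨-absorbs-∧ : ∀ x y → x ∨ (x ∧ y) ≡ x
    ∨-absorbs-∧ x y = begin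
      x ∨ (x ∧ y)            ≡⟨ ∨-distribˡ-p x z x y ⟩
      p (x ∨ z) x (x ∨ y)    ≡⟨ cong (λ u → p u x (x ∨ y)) (p-zero x o) ⟩
      p x x (x ∨ y)          ≡⟨ diagonal x (x ∨ y) ⟩
      x ∧ (x ∨ y)            ≡⟨ ∧-absorbs-∨ x y ⟩
      x                      ∎

    ∧-distribʳ-∨ : ∀ u v w → (v ∨ w) ∧ u ≡ (v ∧ u) ∨ (w ∧ u)
    ∧-distribʳ-∨ u v w = begin
      (v ∨ w) ∧ u                    ≡⟨ ∧-distribʳ-p v w o u ⟩
      p (v ∧ u) w (o ∧ u)            ≡⟨ cong (p (v ∧ u) w) (p-one z u) ⟩
      p (v ∧ u) w u                  ≡⟨ cong₂ (λ s t → p s w t) (p-zero (v ∧ u) o) v∧u∨u≡u ⟨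
      p ((v ∧ u) ∨ z) w ((v ∧ u) ∨ u) ≡⟨ ∨-distribˡ-p (v ∧ u) z w u ⟨
      (v ∧ u) ∨ (w ∧ u)              ∎
      where
      v∧u∨u≡u : (v ∧ u) ∨ u ≡ u
      v∧u∨u≡u = begin
        (v ∧ u) ∨ u          ≡⟨ ∨-comm (v ∧ u) u ⟩
        u ∨ (v ∧ u)          ≡⟨ cong (u ∨_) (∧-comm v u) ⟩
        u ∨ (u ∧ v)          ≡⟨ ∨-absorbs-∧ u v ⟩
        u                    ∎

    ∧-complementʳ : ∀ x → x ∧ (¬ x) ≡ z
    ∧-complementʳ x = begin
      p z x (¬ x)            ≡⟨ p-¬ (¬ x) x z ⟨
      p (¬ x) (¬ x) z        ≡⟨ diagonal (¬ x) z ⟩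
      p z (¬ x) z            ≡⟨ C2 z (¬ x) ⟩
      z                      ∎

    ∨-complementʳ : ∀ x → x ∨ (¬ x) ≡ o
    ∨-complementʳ x = ¬-injective (begin
      ¬ (x ∨ (¬ x))          ≡⟨ ¬-distrib-∨ x (¬ x) ⟩
      (¬ (¬ x)) ∧ (¬ x)      ≡⟨ cong (_∧ (¬ x)) (¬-involutive x) ⟩
      x ∧ (¬ x)              ≡⟨ ∧-complementʳ x ⟩
      z                      ≡⟨ p-one o z ⟨
      ¬ o                    ∎)

    isLattice : IsLattice _≡_ _∨_ _∧_
    isLattice = record
      { isEquivalence = isEquivalence
      ; ∨-comm        = ∨-comm
      ; ∨-assoc       = ∨-assoc
      ; ∨-cong        = cong₂ _∨_
      ; ∧-comm        = ∧-comm
      ; ∧-assoc       = ∧-assoc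
      ; ∧-cong        = cong₂ _∧_
      ; absorptive    = ∨-absorbs-∧ , ∧-absorbs-∨
      }

    isDistributiveLattice : IsDistributiveLattice _≡_ _∨_ _∧_
    isDistributiveLattice = record
      { isLattice   = isLattice
      ; ∨-distrib-∧ = comm∧distrˡ⇒distr (cong₂ _∧_) ∨-comm
                        (distrib∧absorbs⇒distribˡ (cong₂ _∨_) ∨-assoc ∧-comm ∨-absorbs-∧ ∧-absorbs-∨ ∧-distrib-∨)
      ; ∧-distrib-∨ = ∧-distrib-∨
      }
      where
      ∧-distrib-∨ = comm∧distrʳ⇒distrˡ ∧-comm ∧-distribʳ-∨ , ∧-distribʳ-∨

    DiagonalMeet⇒IsBooleanAlgebra : IsBooleanAlgebra _≡_ _∨_ _∧_ ¬_ o z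
    DiagonalMeet⇒IsBooleanAlgebra = isBooleanAlgebraʳ (record
      { isDistributiveLattice = isDistributiveLattice
      ; ∨-complementʳ         = ∨-complementʳ
      ; ∧-complementʳ         = ∧-complementʳ
      ; ¬-cong                = cong ¬_
      })

theorem1 : {A : Set} (p : A → A → A → A) (z o : A) → IsC p z o
    → let open Ops p z o in
      (Commutative _≡_ _∧_ ⊎ Commutative _≡_ _∨_)
    → (IsBooleanAlgebra _≡_ _∨_ _∧_ ¬_ o z ⇔ (∀ a b c → p a b c ≡ ((¬ b) ∧ a) ∨ (b ∧ c)))
      × ((∀ a b c → p a b c ≡ ((¬ b) ∧ a) ∨ (b ∧ c)) ⇔ (∀ a b → p a a b ≡ p z a b))
theorem1 p z o C commutative =
    mk⇔ (IsBooleanAlgebra⇒IfThenElse C) (λ ite → isBooleanAlgebra (IfThenElse⇒DiagonalMeet C ite))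
  , mk⇔ (IfThenElse⇒DiagonalMeet C) (λ diagonal → IsBooleanAlgebra⇒IfThenElse C (isBooleanAlgebra diagonal))
  where
  open Ops p z o

  ∧-comm : Commutative _≡_ _∧_
  ∧-comm = [ id , ∨-comm⇒∧-comm C ]′ commutative

  isBooleanAlgebra : DiagonalMeet C → IsBooleanAlgebra _≡_ _∨_ _∧_ ¬_ o z
  isBooleanAlgebra diagonal = DiagonalMeet⇒IsBooleanAlgebra C diagonal ∧-comm
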